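{- Let $\mathbf{q}=(q_1,\ldots,q_n)\in\mathbb{Z}_{\geq1}^n$ satisfy $\mathrm{rsn}(\mathbf{q})=1$ and $\ell(\mathrm{rs}(\mathbf{q}))=1$, i.e. $1+\sum_{i=1}^n q_i=\mathrm{lcm}(\mathbf{q})-1$, so that $\mathrm{rs}(\mathbf{q})=(1,q_1,\ldots,q_n)$. Then for all $0\leq b\leq\sum_i q_i$ we have $w(\mathbf{q},b)=w(\mathrm{rs}(\mathbf{q}),b)$, and hence \[ h^*(\Delta_{(1,\mathrm{rs}(\mathbf{q}))};z)=h^*(\Delta_{(1,\mathbf{q})};z)+z^{n+1}. \]
   Context: For $\mathbf{p}=(p_1,\ldots,p_N)\in\mathbb{Z}_{\geq1}^N$, $\Delta_{(1,\mathbf{p})}:=\mathrm{conv}\{\mathbf{e}_1,\ldots,\mathbf{e}_N,-\sum_ip_i\mathbf{e}_i\}\subset\mathbb{R}^N$, reflexive iff each $p_i$ divides $1+\sum_jp_j$. $\mathrm{rsn}(\mathbf{q})$ is the least $k\ge0$ such that $\Delta_{(1,(1^k,\mathbf{q}))}$ is reflexive and $\mathrm{rs}(\mathbf{q}):=(1^{\mathrm{rsn}(\mathbf{q})},\mathbf{q})$ ($k$ ones prepended). For reflexive $\mathbf{p}$, $\ell(\mathbf{p})$ is the integer with $1+\sum_ip_i=\ell(\mathbf{p})\,\mathrm{lcm}(\mathbf{p})$. For $\mathbf{p}\in\mathbb{Z}_{\ge1}^N$ and integer $b$, $w(\mathbf{p},b):=b-\sum_{i=1}^N\left\lfloor\frac{p_ib}{1+p_1+\cdots+p_N}\right\rfloor$.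 The $h^*$-polynomial is defined by $\sum_{t\geq0}|tP\cap\mathbb{Z}^N|z^t=h^*(P;z)/(1-z)^{\dim P+1}$; for these simplices $h^*(\Delta_{(1,\mathbf{p})};z)=\sum_{b=0}^{p_1+\cdots+p_N}z^{w(\mathbf{p},b)}$. -}

module Defs where

open import Data.Nat using (ℕ; zero; suc; _+_; _*_; _≤_; _<_)
open import Data.Nat.Divisibility using (_∣_)
open import Data.Nat.DivMod using (_/_)
open import Data.Nat.LCM using (lcm)
open import Data.Integer as ℤ using (ℤ; +_)
open import Data.Integer.Properties using () renaming (_≟_ to _≟ℤ_)
open import Data.Vec using (Vec; []; _∷_; replicate; _++_; sum; foldr′; toList)
open import Data.Vec.Relation.Unary.All using (All)
open import Data.List as List using (List; length; filter; upTo)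
open import Relation.Nullary using (¬_)

Positive : ∀ {N} → Vec ℕ N → Set
Positive p = All (λ x → 1 ≤ x) p

-- Δ_(1,p) is reflexive iff each p_i divides 1 + Σ_j p_j
Reflexive : ∀ {N} → Vec ℕ N → Set
Reflexive p = All (λ x → x ∣ suc (sum p)) p

onesThen : ∀ {n} (k : ℕ) → Vec ℕ n → Vec ℕ (k + n)
onesThen k q = replicate k 1 ++ q

RsnIs : ∀ {n} → Vec ℕ n → ℕ → Set
RsnIs q k = Reflexive (onesThen k q) × (∀ j → j < k → ¬ Reflexive (onesThen j q))
  where open import Data.Product using (_×_)

rsWith : ∀ {n} (k : ℕ) → Vec ℕ n → Vec ℕ (k + n)
rsWith = onesThen

lcmVec : ∀ {N} → Vec ℕ N → ℕ
lcmVec = foldr′ lcm 1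

EllIs : ∀ {N} → Vec ℕ N → ℕ → Set
EllIs p l = suc (sum p) ≡ l * lcmVec p
  where open import Relation.Binary.PropositionalEquality using (_≡_)

-- w(p,b) = b - Σ_i ⌊ p_i b / (1 + Σ p) ⌋   (b ≥ 0, so the floors are ℕ-divisions)
w : ∀ {N} → Vec ℕ N → ℕ → ℤ
w p b = (+ b) ℤ.- (+ sum (Data.Vec.map (λ x → (x * b) / suc (sum p)) p))

-- coefficient of z^k in h*(Δ_(1,p); z) = Σ_{b=0}^{Σp} z^{w(p,b)}
hstarCoeff : ∀ {N} → Vec ℕ N → ℤ → ℕ
hstarCoeff p k = length (filter (λ b → w p b ≟ℤ k) (upTo (suc (sum p))))

monoCoeff : ℕ → ℤ → ℕ
monoCoeff m k with (+ m) ≟ℤ k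
... | Relation.Nullary.yes _ = 1
... | Relation.Nullary.no _ = 0

{-# OPTIONS --safe #-}
-- Reflexivity of Δ_(1,(1,q)) says every q_i divides N = 2 + Σq. For such a divisor x and
-- b ≤ Σq, the floors ⌊xb/(N-1)⌋ and ⌊xb/N⌋ agree, and the extra entry 1 contributes
-- ⌊b/N⌋ = 0; so w(q,b) = w(rs q,b) on the common range 0 ≤ b ≤ Σq. The one new value
-- b = N - 1 of rs q has ⌊x(N-1)/N⌋ = x - 1 for every entry x, whence w = (N-1) - (Σq - n) = n + 1.
module Submission where

open import Defs
open import Data.Nat using (ℕ; suc; _+_; _*_; _≤_; _<_; z≤n; s≤s; >-nonZero)
open import Data.Nat.Properties
open import Data.Nat.DivMod using (_/_; m/n*n≤m; m*n/n≡m; /-monoˡ-≤; /-monoʳ-≤; m<n⇒m/n≡0; m<n*o⇒m/o<n)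
open import Data.Nat.Divisibility using (_∣_; divides; ∣⇒≤)
open import Data.Integer as ℤ using (ℤ; +_)
open import Data.Integer.Properties using ([+m]-[+n]≡m⊖n; +-cancelˡ-⊖) renaming (_≟_ to _≟ℤ_)
open import Data.Vec using (Vec; sum; []; _∷_; map)
open import Data.Vec.Relation.Unary.All as All using (All; []; _∷_)
open import Data.List.Relation.Unary.All as ListAll using ()
open import Data.List as List using (List; length; filter; upTo)
open import Data.List.Properties using (upTo-∷ʳ; filter-++; length-++)
open import Data.List.Relation.Unary.All.Properties using (applyUpTo⁺₁)
open import Data.Product using (_×_; _,_)
open import Relation.Nullary using (yes; no)
open import Relation.Binary.PropositionalEquality
open import Function using (id)

∣suc⇒pos : ∀ {x m} → x ∣ suc m → 0 < x
∣suc⇒pos {suc _} _ = s≤s z≤n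
∣suc⇒pos {0} (divides k eq) with () ← trans eq (*-zeroʳ k)

-- With N = x m, the bound k (N - 1) ≤ x b and k < x give k m x < x (b + 1), so k N ≤ x b.
/-suc-stable-∣ : ∀ {S b x} → b ≤ S → x ∣ suc (suc S) → x * b / suc S ≡ x * b / suc (suc S)
/-suc-stable-∣ {S} {b} {x} b≤S x∣N@(divides m N≡mx) =
  ≤-antisym k≤x*b/N (/-monoʳ-≤ (x * b) (n≤1+n (suc S)))
  where
  instance _ = >-nonZero (∣suc⇒pos x∣N)
  k = x * b / suc S
  kd≤xb : k * suc S ≤ x * b
  kd≤xb = m/n*n≤m (x * b) (suc S)
  k<x : k < x
  k<x = *-cancelʳ-< (suc S) k x (≤-<-trans kd≤xb (*-monoʳ-< x (s≤s b≤S)))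
  kN≡kmx : k * suc (suc S) ≡ k * m * x
  kN≡kmx = trans (cong (k *_) N≡mx) (sym (*-assoc k m x))
  kmx<x[1+b] : k * m * x < suc b * x
  kmx<x[1+b] = begin-strict
    k * m * x         ≡⟨ kN≡kmx ⟨
    k * suc (suc S)   ≡⟨ *-suc k (suc S) ⟩
    k + k * suc S     <⟨ +-mono-<-≤ k<x kd≤xb ⟩
    x + x * b         ≡⟨ *-suc x b ⟨
    x * suc b         ≡⟨ *-comm x (suc b) ⟩
    suc b * x         ∎
    where open ≤-Reasoning
  kN≤xb : k * suc (suc S) ≤ x * b
  kN≤xb = begin
    k * suc (suc S)   ≡⟨ kN≡kmx ⟩
    k * m * x         ≤⟨ *-monoˡ-≤ x (≤-pred (*-cancelʳ-< x (k * m) (suc b) kmx<x[1+b])) ⟩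
    b * x             ≡⟨ *-comm b x ⟩
    x * b             ∎
    where open ≤-Reasoning
  k≤x*b/N : k ≤ x * b / suc (suc S)
  k≤x*b/N = subst (_≤ x * b / suc (suc S)) (m*n/n≡m k (suc (suc S))) (/-monoˡ-≤ (suc (suc S)) kN≤xb)

[1+m]*n/[1+n]≡m : ∀ {m n} → m ≤ n → suc m * n / suc n ≡ m
[1+m]*n/[1+n]≡m {m} {n} m≤n = ≤-antisym upper lower
  where
  upper : suc m * n / suc n ≤ m
  upper = ≤-pred (m<n*o⇒m/o<n (*-monoʳ-< (suc m) (n<1+n n)))
  m[1+n]≤[1+m]n : m * suc n ≤ suc m * n
  m[1+n]≤[1+m]n = begin
    m * suc n   ≡⟨ *-suc m n ⟩
    m + m * n   ≤⟨ +-monoˡ-≤ (m * n) m≤n ⟩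
    n + m * n   ∎
    where open ≤-Reasoning
  lower : m ≤ suc m * n / suc n
  lower = subst (_≤ suc m * n / suc n) (m*n/n≡m m (suc n)) (/-monoˡ-≤ (suc n) m[1+n]≤[1+m]n)

sum-map-congᴬ : ∀ {n} {f g : ℕ → ℕ} {v : Vec ℕ n} → All (λ x → f x ≡ g x) v →
  sum (map f v) ≡ sum (map g v)
sum-map-congᴬ []           = refl
sum-map-congᴬ (fx≡gx ∷ eqs) = cong₂ _+_ fx≡gx (sum-map-congᴬ eqs)

sum-map-predᴬ : ∀ {n} {f : ℕ → ℕ} {v : Vec ℕ n} → All (λ x → suc (f x) ≡ x) v →
  sum (map f v) + n ≡ sum v
sum-map-predᴬ {f = f} {v = []} [] = refl
sum-map-predᴬ {suc n} {f} {x ∷ v} (sfx≡x ∷ eqs) = begin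
  f x + T + suc n     ≡⟨ +-assoc (f x) T (suc n) ⟩
  f x + (T + suc n)   ≡⟨ cong (λ t → f x + t) (+-suc T n) ⟩
  f x + suc (T + n)   ≡⟨ +-suc (f x) (T + n) ⟩
  suc (f x) + (T + n) ≡⟨ cong₂ _+_ sfx≡x (sum-map-predᴬ eqs) ⟩
  x + sum v           ∎
  where
  open ≡-Reasoning
  T = sum (map f v)

countℤ : (ℕ → ℤ) → ℤ → List ℕ → ℕ
countℤ f k xs = length (filter (λ b → f b ≟ℤ k) xs)

countℤ-congᴬ : ∀ {f g : ℕ → ℤ} k {xs} → ListAll.All (λ b → f b ≡ g b) xs → countℤ f k xs ≡ countℤ g k xs
countℤ-congᴬ k ListAll.[] = refl
countℤ-congᴬ {f} {g} k {x List.∷ xs} (fx≡gx ListAll.∷ eqs) with f x | fx≡gx | countℤ-congᴬ k eqs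
... | _ | refl | ih with g x ≟ℤ k
...   | yes _ = cong suc ih
...   | no _  = ih

countℤ-upTo-suc : ∀ (f : ℕ → ℤ) k {m j} → f m ≡ + j →
  countℤ f k (upTo (suc m)) ≡ countℤ f k (upTo m) + monoCoeff j k
countℤ-upTo-suc f k {m} {j} fm≡j = begin
  countℤ f k (upTo (suc m))                     ≡⟨ cong (countℤ f k) (upTo-∷ʳ m) ⟨
  countℤ f k (upTo m List.++ List.[ m ])        ≡⟨ cong length (filter-++ P? (upTo m) List.[ m ]) ⟩
  length (filter P? (upTo m) List.++ filter P? List.[ m ])
                                                ≡⟨ length-++ (filter P? (upTo m)) ⟩
  countℤ f k (upTo m) + countℤ f k List.[ m ]   ≡⟨ cong (λ t → countℤ f k (upTo m) + t) single ⟩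
  countℤ f k (upTo m) + monoCoeff j k           ∎
  where
  open ≡-Reasoning
  P? = λ b → f b ≟ℤ k
  single : countℤ f k List.[ m ] ≡ monoCoeff j k
  single rewrite fm≡j with + j ≟ℤ k
  ... | yes _ = refl
  ... | no _  = refl

module _ {n} (q : Vec ℕ n) (rs-reflexive : Reflexive (1 ∷ q)) where

  private
    S = sum q
    q∣N : All (λ x → x ∣ suc (suc S)) q
    q∣N = All.tail rs-reflexive

  w-rs-agree : ∀ {b} → b ≤ S → w q b ≡ w (1 ∷ q) b
  w-rs-agree {b} b≤S = cong (λ t → + b ℤ.- + t) (begin
    sum (map (λ x → x * b / suc S) q)            ≡⟨ sum-map-congᴬ (All.map (/-suc-stable-∣ b≤S) q∣N) ⟩
    sum (map (λ x → x * b / suc (suc S)) q)      ≡⟨ cong (_+ sum (map (λ x → x * b / suc (suc S)) q)) b/N≡0 ⟨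
    1 * b / suc (suc S) + sum (map (λ x → x * b / suc (suc S)) q) ∎)
    where
    open ≡-Reasoning
    b/N≡0 : 1 * b / suc (suc S) ≡ 0
    b/N≡0 = m<n⇒m/n≡0 (s≤s (≤-trans (≤-reflexive (*-identityˡ b)) (m≤n⇒m≤1+n b≤S)))

  w-rs-top : w (1 ∷ q) (suc S) ≡ + suc n
  w-rs-top = begin
    + suc S ℤ.- + (1 * suc S / suc (suc S) + T) ≡⟨ cong (λ t → + suc S ℤ.- + (t + T)) top/N≡0 ⟩
    + suc S ℤ.- + T                             ≡⟨ [+m]-[+n]≡m⊖n (suc S) T ⟩
    suc S ℤ.⊖ T                                 ≡⟨ cong₂ ℤ._⊖_ S+1≡T+n+1 (sym (+-identityʳ T)) ⟩
    (T + suc n) ℤ.⊖ (T + 0)                     ≡⟨ +-cancelˡ-⊖ T (suc n) 0 ⟩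
    + suc n                                     ∎
    where
    open ≡-Reasoning
    T = sum (map (λ x → x * suc S / suc (suc S)) q)
    top/N≡0 : 1 * suc S / suc (suc S) ≡ 0
    top/N≡0 = m<n⇒m/n≡0 (s≤s (≤-reflexive (*-identityˡ (suc S))))
    floor-top : ∀ {x} → x ∣ suc (suc S) → suc (x * suc S / suc (suc S)) ≡ x
    floor-top {suc y} x∣N = cong suc ([1+m]*n/[1+n]≡m (≤-pred (∣⇒≤ x∣N)))
    floor-top {0} x∣N with () ← ∣suc⇒pos x∣N
    S+1≡T+n+1 : suc S ≡ T + suc n
    S+1≡T+n+1 = trans (cong suc (sym (sum-map-predᴬ (All.map floor-top q∣N)))) (sym (+-suc T n))

  hstarCoeff-rs : ∀ k → hstarCoeff (1 ∷ q) k ≡ hstarCoeff q k + monoCoeff (suc n) k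
  hstarCoeff-rs k = begin
    countℤ (w (1 ∷ q)) k (upTo (suc (suc S)))                    ≡⟨ countℤ-upTo-suc (w (1 ∷ q)) k w-rs-top ⟩
    countℤ (w (1 ∷ q)) k (upTo (suc S)) + monoCoeff (suc n) k    ≡⟨ cong (_+ _) agree ⟩
    countℤ (w q) k (upTo (suc S)) + monoCoeff (suc n) k          ∎
    where
    open ≡-Reasoning
    agree : countℤ (w (1 ∷ q)) k (upTo (suc S)) ≡ countℤ (w q) k (upTo (suc S))
    agree = countℤ-congᴬ k (applyUpTo⁺₁ id (suc S) (λ {i} i<S+1 → sym (w-rs-agree {i} (≤-pred i<S+1))))

theorem5p5 : (n : ℕ) (q : Vec ℕ n) → Positive q → RsnIs q 1 → EllIs (rsWith 1 q) 1 →
    ((b : ℕ) → b ≤ sum q → w q b ≡ w (rsWith 1 q) b)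
    × ((k : ℤ) → hstarCoeff (rsWith 1 q) k ≡ hstarCoeff q k + monoCoeff (suc n) k)
theorem5p5 n q _ (reflexive , _) _ = (λ b → w-rs-agree q reflexive) , hstarCoeff-rs q reflexive
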